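{- Let $T$ be a tree of order $n\ge 2$, and let $T_s$ be the tree of order $2n-1$ obtained by subdividing each edge of $T$ exactly once. Then $\mathcal{B}_n(\overline{T_s})\cong T$, where $\overline{T_s}$ is the complement of $T_s$.
   Context: A stable $k$-partition of a graph $G$ is a multiset of $k$ independent sets of $G$ (some possibly empty) partitioning $V(G)$; for $v\in V(G)$, $P-v$ is obtained by deleting $v$ from its part. The Bell $k$-coloring graph $\mathcal{B}_k(G)$ has vertex set the stable $k$-partitions of $G$, with distinct $P,Q$ adjacent iff $P-v=Q-v$ for some $v\in V(G)$. -}

module Defs where

open import Data.Nat using (ℕ; _≤_)
open import Data.Fin using (Fin; _<_)
open import Data.Bool using (Bool; true; false)
open import Data.Product using (Σ; ∃; _×_; _,_; proj₁; proj₂)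
open import Data.Sum using (_⊎_; inj₁; inj₂)
open import Data.Empty using (⊥)
open import Data.List using (List; _∷_; []; _∷ʳ_; length)
open import Data.List.Relation.Unary.Linked using (Linked)
open import Data.List.Relation.Unary.Unique.Propositional using (Unique)
open import Relation.Binary.PropositionalEquality using (_≡_; _≢_)
open import Relation.Nullary using (¬_)

record SimpleGraph (n : ℕ) : Set where
  field
    adj    : Fin n → Fin n → Bool
    sym    : ∀ x y → adj x y ≡ adj y x
    irrefl : ∀ x → adj x x ≡ false

open SimpleGraph public

Adj : ∀ {n} → SimpleGraph n → Fin n → Fin n → Set
Adj G x y = adj G x y ≡ true

data Walk {n} (G : SimpleGraph n) : Fin n → Fin n → Set where
  [] : ∀ {x} → Walk G x x
  _∷_ : ∀ {x y z} → Adj G x y → Walk G y z → Walk G x z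

Connected : ∀ {n} → SimpleGraph n → Set
Connected G = ∀ x y → Walk G x y

HasCycle : ∀ {n} → SimpleGraph n → Set
HasCycle {n} G =
  Σ (Fin n) λ x → Σ (List (Fin n)) λ xs →
    (2 ≤ length xs) × Unique (x ∷ xs) × Linked (Adj G) ((x ∷ xs) ∷ʳ x)

IsTree : ∀ {n} → SimpleGraph n → Set
IsTree G = Connected G × ¬ HasCycle G

-- Subdivision: every edge {u,v} (recorded once, as u < v) gets a new vertex.

EdgeOf : ∀ {n} → SimpleGraph n → Set
EdgeOf {n} G = Σ (Fin n × Fin n) λ p → (proj₁ p < proj₂ p) × Adj G (proj₁ p) (proj₂ p)

SubdivV : ∀ {n} → SimpleGraph n → Set
SubdivV {n} G = Fin n ⊎ EdgeOf G

SubdivAdj : ∀ {n} (G : SimpleGraph n) → SubdivV G → SubdivV G → Set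
SubdivAdj G (inj₁ x) (inj₂ ((u , v) , _)) = x ≡ u ⊎ x ≡ v
SubdivAdj G (inj₂ ((u , v) , _)) (inj₁ x) = x ≡ u ⊎ x ≡ v
SubdivAdj G (inj₁ _) (inj₁ _) = ⊥
SubdivAdj G (inj₂ _) (inj₂ _) = ⊥

ComplAdj : {V : Set} → (V → V → Set) → V → V → Set
ComplAdj R a b = a ≢ b × ¬ R a b

-- A stable k-partition (multiset of k independent sets, possibly empty,
-- partitioning V) is represented by a proper colouring c : V → Fin k
-- (part i = c⁻¹(i)); two colourings represent the same multiset of parts
-- iff they have the same kernel (SamePart).

StableCol : (V : Set) → (V → V → Set) → ℕ → Set
StableCol V R k = Σ (V → Fin k) λ c → ∀ a b → R a b → c a ≢ c b

SamePart : ∀ {V R k} → StableCol V R k → StableCol V R k → Set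
SamePart {V} (c , _) (d , _) =
  ∀ (a b : V) → (c a ≡ c b → d a ≡ d b) × (d a ≡ d b → c a ≡ c b)

SamePartMinus : ∀ {V R k} → V → StableCol V R k → StableCol V R k → Set
SamePartMinus {V} v (c , _) (d , _) =
  ∀ (a b : V) → a ≢ v → b ≢ v →
    (c a ≡ c b → d a ≡ d b) × (d a ≡ d b → c a ≡ c b)

BellAdj : ∀ {V R k} → StableCol V R k → StableCol V R k → Set
BellAdj {V} P Q = ¬ SamePart P Q × Σ V λ v → SamePartMinus v P Q

-- Graph isomorphism  B_k(V,R) ≅ G, with vertices of B_k taken up to SamePart
BellIso : ∀ {n} (V : Set) (R : V → V → Set) (k : ℕ) → SimpleGraph n → Set
BellIso {n} V R k G =
  Σ (Fin n → StableCol V R k) λ f →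
    (∀ x y → SamePart (f x) (f y) → x ≡ y)
    × (∀ P → Σ (Fin n) λ x → SamePart (f x) P)
    × (∀ x y → (Adj G x y → BellAdj (f x) (f y)) × (BellAdj (f x) (f y) → Adj G x y))

-- In the complement of T_s the vertices of T are pairwise adjacent, so a stable n-partition puts
-- them in n different parts, and the vertex subdividing an edge, being adjacent to everything but
-- the two endpoints, joins the part of one endpoint, distinct edges going to distinct parts. Stable
-- n-partitions are therefore the injective choices of an endpoint for every edge. Since T has n − 1
-- edges such a choice misses some vertex r, and then it must choose for every edge the endpoint
-- farther from r; so the partitions correspond to the vertices r. Moving the root r across an edge
-- rs only moves the vertex subdividing rs, whereas for non-adjacent r ≠ s the edge-vertices next to
-- s towards r and next to r towards s both change part, so no single vertex can be deleted.
module Submission where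

open import Defs hiding (sym)
open import Axiom.UniquenessOfIdentityProofs using (module Decidable⇒UIP)
open import Data.Bool as Bool using (true)
open import Data.Fin as Fin using (Fin; punchOut)
import Data.Fin.Properties as Fin
open import Data.List using (List; []; _∷_; _∷ʳ_; reverse; length)
open import Data.List.Properties using (unfold-reverse; reverse-++; reverse-involutive)
open import Data.List.Relation.Unary.All as All using (All; []; _∷_)
import Data.List.Relation.Unary.All.Properties as Allₚ
open import Data.List.Relation.Unary.AllPairs as AllPairs using (AllPairs; []; _∷_)
import Data.List.Relation.Unary.AllPairs.Properties as AllPairsₚ
open import Data.List.Relation.Unary.Linked using (Linked; []; [-]; _∷_)
open import Data.Nat as ℕ using (ℕ; zero; suc; _+_; _≤_; z≤n; s≤s)
import Data.Nat.Properties as ℕ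
open import Data.Nat.Induction using (<-wellFounded)
open import Data.Product using (Σ; ∃; _×_; _,_; proj₁; proj₂; swap)
import Data.Product.Properties as Product
open import Data.Sum using (_⊎_; inj₁; inj₂; [_,_]′)
import Data.Sum as Sum
import Data.Sum.Properties as Sum
open import Function using (_∘_; id)
open import Function.Definitions using (Injective)
open import Induction.WellFounded using (Acc; acc)
open import Relation.Binary using (Symmetric; DecidableEquality; tri<; tri≈; tri>)
open import Relation.Binary.PropositionalEquality
open import Relation.Nullary using (¬_; Dec; yes; no; contradiction; ¬?)
open import Relation.Nullary.Decidable using (_×-dec_; _⊎-dec_; map′; decidable-stable)

least : {P : ℕ → Set} → (∀ k → Dec (P k)) → ∀ m → P m →
        ∃ λ k → P k × (∀ j → P j → k ≤ j)
least P? zero p0 = zero , p0 , λ _ _ → z≤n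
least P? (suc m) pm with P? zero
... | yes p0 = zero , p0 , λ _ _ → z≤n
... | no ¬p0 with least (P? ∘ suc) m pm
...   | k , pk , minimal = suc k , pk , λ where
          zero p0 → contradiction p0 ¬p0
          (suc j) pj → s≤s (minimal j pj)

injective⇒surjective : ∀ {n} {f : Fin n → Fin n} → Injective _≡_ _≡_ f →
                       ∀ y → ∃ λ x → f x ≡ y
injective⇒surjective {suc n} {f} f-injective y with Fin.any? (λ x → f x Fin.≟ y)
... | yes hit = hit
... | no ¬hit = contradiction (Fin.injective⇒≤ punchOut∘f-injective) ℕ.1+n≰n
  where
  y≢f : ∀ x → y ≢ f x
  y≢f x y≡fx = ¬hit (x , sym y≡fx)

  punchOut∘f-injective : Injective _≡_ _≡_ (λ x → punchOut (y≢f x))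
  punchOut∘f-injective = f-injective ∘ Fin.punchOut-injective (y≢f _) (y≢f _)

module _ {A : Set} where

  reverse-∷-∷ʳ : ∀ (x : A) xs y → reverse (x ∷ xs ∷ʳ y) ≡ y ∷ reverse xs ∷ʳ x
  reverse-∷-∷ʳ x xs y =
    trans (unfold-reverse x (xs ∷ʳ y)) (cong (_∷ʳ x) (reverse-++ xs (y ∷ [])))

  All-reverse⁺ : ∀ {P : A → Set} {xs} → All P xs → All P (reverse xs)
  All-reverse⁺ [] = []
  All-reverse⁺ {P} {x ∷ xs} (px ∷ pxs) =
    subst (All P) (sym (unfold-reverse x xs)) (Allₚ.∷ʳ⁺ (All-reverse⁺ pxs) px)

  AllPairs-∷ʳ⁺ : ∀ {R : A → A → Set} {xs x} →
                 AllPairs R xs → All (λ z → R z x) xs → AllPairs R (xs ∷ʳ x)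
  AllPairs-∷ʳ⁺ rxs rx = AllPairsₚ.++⁺ rxs ([] ∷ []) (All.map (_∷ []) rx)

  Linked-∷ʳ⁺ : ∀ {R : A → A → Set} {xs x y} →
               Linked R (xs ∷ʳ x) → R x y → Linked R (xs ∷ʳ x ∷ʳ y)
  Linked-∷ʳ⁺ {xs = []} [-] rxy = rxy ∷ [-]
  Linked-∷ʳ⁺ {xs = _ ∷ []} (r ∷ [-]) rxy = r ∷ rxy ∷ [-]
  Linked-∷ʳ⁺ {xs = _ ∷ xs@(_ ∷ _)} (r ∷ rs) rxy = r ∷ Linked-∷ʳ⁺ {xs = xs} rs rxy

  module _ {R : A → A → Set} (R-sym : Symmetric R) where

    AllPairs-reverse⁺ : ∀ {xs} → AllPairs R xs → AllPairs R (reverse xs)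
    AllPairs-reverse⁺ [] = []
    AllPairs-reverse⁺ {x ∷ xs} (rx ∷ rxs) =
      subst (AllPairs R) (sym (unfold-reverse x xs))
        (AllPairs-∷ʳ⁺ (AllPairs-reverse⁺ rxs) (All-reverse⁺ (All.map R-sym rx)))

    Linked-reverse⁺ : ∀ {xs} → Linked R xs → Linked R (reverse xs)
    Linked-reverse⁺ [] = []
    Linked-reverse⁺ [-] = [-]
    Linked-reverse⁺ {x ∷ y ∷ xs} (rxy ∷ rs) =
      subst (Linked R) (sym (trans (unfold-reverse x (y ∷ xs)) (cong (_∷ʳ x) (unfold-reverse y xs))))
        (Linked-∷ʳ⁺ (subst (Linked R) (unfold-reverse y xs) (Linked-reverse⁺ rs)) (R-sym rxy))

-- SamePart and SamePartMinus unfold to statements about the bare colourings, so the partitions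
-- they relate cannot be inferred and are passed explicitly.
module _ {V : Set} {R : V → V → Set} {k : ℕ} where

  SamePart-refl : (P : StableCol V R k) → SamePart P P
  SamePart-refl _ _ _ = id , id

  SamePart-trans : (P Q S : StableCol V R k) → SamePart P Q → SamePart Q S → SamePart P S
  SamePart-trans _ _ _ P~Q Q~S a b =
    proj₁ (Q~S a b) ∘ proj₁ (P~Q a b) , proj₂ (P~Q a b) ∘ proj₂ (Q~S a b)

  SamePart-viaInjection : (P Q : StableCol V R k) {π : Fin k → Fin k} → Injective _≡_ _≡_ π →
                          (∀ a → proj₁ Q a ≡ π (proj₁ P a)) → SamePart P Q
  SamePart-viaInjection _ _ {π} π-injective Q≡πP a b =
    (λ eq → trans (Q≡πP a) (trans (cong π eq) (sym (Q≡πP b)))) ,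
    (λ eq → π-injective (trans (sym (Q≡πP a)) (trans eq (Q≡πP b))))

  SamePartMinus-sym : ∀ {v} (P Q : StableCol V R k) → SamePartMinus v P Q → SamePartMinus v Q P
  SamePartMinus-sym _ _ P~Q a b a≢v b≢v = swap (P~Q a b a≢v b≢v)

  SamePartMinus-pointwise : ∀ {v} (P Q : StableCol V R k) →
                            (∀ a → a ≢ v → proj₁ P a ≡ proj₁ Q a) → SamePartMinus v P Q
  SamePartMinus-pointwise _ _ P≡Q a b a≢v b≢v =
    (λ eq → trans (sym (P≡Q a a≢v)) (trans eq (P≡Q b b≢v))) ,
    (λ eq → trans (P≡Q a a≢v) (trans eq (sym (P≡Q b b≢v))))

  SamePartMinus-separated : DecidableEquality V → ∀ {v} (P Q : StableCol V R k) →
                            SamePartMinus v P Q → ∀ {a b} →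
                            proj₁ P a ≡ proj₁ P b → proj₁ Q a ≢ proj₁ Q b → a ≡ v ⊎ b ≡ v
  SamePartMinus-separated _≟_ {v} _ _ P~Q {a} {b} Pab ¬Qab with a ≟ v | b ≟ v
  ... | yes a≡v | _ = inj₁ a≡v
  ... | no _ | yes b≡v = inj₂ b≡v
  ... | no a≢v | no b≢v = contradiction (proj₁ (P~Q a b a≢v b≢v) Pab) ¬Qab

module Subdivision {n} (G : SimpleGraph n) where

  Adj-sym : ∀ {x y} → Adj G x y → Adj G y x
  Adj-sym {x} {y} x~y = trans (SimpleGraph.sym G y x) x~y

  Adj-irrefl : ∀ {x y} → Adj G x y → x ≢ y
  Adj-irrefl {x} x~x refl = contradiction (trans (sym x~x) (irrefl G x)) λ ()

  Adj? : ∀ x y → Dec (Adj G x y)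
  Adj? x y = adj G x y Bool.≟ true

  Edge : Set
  Edge = EdgeOf G

  infix 4 _∈ₑ_ _∈ₑ?_

  _∈ₑ_ : Fin n → Edge → Set
  z ∈ₑ ((u , v) , _) = z ≡ u ⊎ z ≡ v

  _∈ₑ?_ : ∀ z e → Dec (z ∈ₑ e)
  z ∈ₑ? ((u , v) , _) = (z Fin.≟ u) ⊎-dec (z Fin.≟ v)

  Joins : Edge → Fin n → Fin n → Set
  Joins ((u , v) , _) x y = (u ≡ x × v ≡ y) ⊎ (u ≡ y × v ≡ x)

  edge : ∀ {x y} → Adj G x y → Edge
  edge {x} {y} x~y with Fin.<-cmp x y
  ... | tri< x<y _ _ = (x , y) , x<y , x~y
  ... | tri≈ _ x≡y _ = contradiction x≡y (Adj-irrefl x~y)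
  ... | tri> _ _ y<x = (y , x) , y<x , Adj-sym x~y

  edge-joins : ∀ {x y} (x~y : Adj G x y) → Joins (edge x~y) x y
  edge-joins {x} {y} x~y with Fin.<-cmp x y
  ... | tri< _ _ _ = inj₁ (refl , refl)
  ... | tri≈ _ x≡y _ = contradiction x≡y (Adj-irrefl x~y)
  ... | tri> _ _ _ = inj₂ (refl , refl)

  Edge-≡ : ∀ {e e' : Edge} → proj₁ e ≡ proj₁ e' → e ≡ e'
  Edge-≡ {_ , u<v , u~v} {_ , u<v' , u~v'} refl =
    cong₂ (λ lt ad → _ , lt , ad)
      (Fin.<-irrelevant u<v u<v') (Decidable⇒UIP.≡-irrelevant Bool._≟_ u~v u~v')

  _≟ₑ_ : DecidableEquality Edge
  e ≟ₑ e' = map′ Edge-≡ (cong proj₁) (Product.≡-dec Fin._≟_ Fin._≟_ (proj₁ e) (proj₁ e'))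

  Joins-injective : ∀ e e' {x y} → Joins e x y → Joins e' x y → e ≡ e'
  Joins-injective _ _ (inj₁ (refl , refl)) (inj₁ (refl , refl)) = Edge-≡ refl
  Joins-injective (_ , u<v , _) (_ , v<u , _) (inj₁ (refl , refl)) (inj₂ (refl , refl)) =
    contradiction v<u (Fin.<-asym u<v)
  Joins-injective (_ , u<v , _) (_ , v<u , _) (inj₂ (refl , refl)) (inj₁ (refl , refl)) =
    contradiction v<u (Fin.<-asym u<v)
  Joins-injective _ _ (inj₂ (refl , refl)) (inj₂ (refl , refl)) = Edge-≡ refl

  Joins-endpoints : ∀ e {x y x' y'} → Joins e x y → Joins e x' y' →
                    (x ≡ x' × y ≡ y') ⊎ (x ≡ y' × y ≡ x')
  Joins-endpoints _ (inj₁ (refl , refl)) (inj₁ (refl , refl)) = inj₁ (refl , refl)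
  Joins-endpoints _ (inj₁ (refl , refl)) (inj₂ (refl , refl)) = inj₂ (refl , refl)
  Joins-endpoints _ (inj₂ (refl , refl)) (inj₁ (refl , refl)) = inj₂ (refl , refl)
  Joins-endpoints _ (inj₂ (refl , refl)) (inj₂ (refl , refl)) = inj₁ (refl , refl)

  Joins⇒∈ₑ : ∀ e {x y} → Joins e x y → x ∈ₑ e
  Joins⇒∈ₑ _ (inj₁ (refl , refl)) = inj₁ refl
  Joins⇒∈ₑ _ (inj₂ (refl , refl)) = inj₂ refl

  ∈ₑ-Joins : ∀ e {x y z} → Joins e x y → z ∈ₑ e → z ≡ x ⊎ z ≡ y
  ∈ₑ-Joins _ (inj₁ (refl , refl)) z∈e = z∈e
  ∈ₑ-Joins _ (inj₂ (refl , refl)) z∈e = Sum.swap z∈e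

  record EndpointChoice : Set where
    field
      choose : Edge → Fin n
      choose-∈ₑ : ∀ e → choose e ∈ₑ e
      choose-injective : Injective _≡_ _≡_ choose
  open EndpointChoice public

  Partition : Set
  Partition = StableCol (SubdivV G) (ComplAdj (SubdivAdj G)) n

  colouring : EndpointChoice → SubdivV G → Fin n
  colouring A (inj₁ x) = x
  colouring A (inj₂ e) = choose A e

  partitionOf : EndpointChoice → Partition
  partitionOf A = colouring A , proper
    where
    proper : ∀ a b → ComplAdj (SubdivAdj G) a b → colouring A a ≢ colouring A b
    proper (inj₁ x) (inj₁ y) (x≢y , _) x≡y = x≢y (cong inj₁ x≡y)
    proper (inj₁ x) (inj₂ e) (_ , x∉e) refl = x∉e (choose-∈ₑ A e)
    proper (inj₂ e) (inj₁ x) (_ , x∉e) refl = x∉e (choose-∈ₑ A e)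
    proper (inj₂ e) (inj₂ e') (e≢e' , _) eq = e≢e' (cong inj₂ (choose-injective A eq))

  partitionOf-cong : ∀ {A B} → (∀ e → choose A e ≡ choose B e) →
                     SamePart (partitionOf A) (partitionOf B)
  partitionOf-cong {A} {B} A≡B = SamePart-viaInjection (partitionOf A) (partitionOf B) {id} id λ where
    (inj₁ x) → refl
    (inj₂ e) → sym (A≡B e)

  module _ (P : Partition) where
    private
      colour = proj₁ P
      proper = proj₂ P

      π : Fin n → Fin n
      π x = colour (inj₁ x)

      π-injective : Injective _≡_ _≡_ π
      π-injective {x} {y} πx≡πy with x Fin.≟ y
      ... | yes x≡y = x≡y
      ... | no x≢y =
        contradiction πx≡πy (proper (inj₁ x) (inj₁ y) (x≢y ∘ Sum.inj₁-injective , λ ()))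

      owner : Edge → Fin n
      owner e = proj₁ (injective⇒surjective π-injective (colour (inj₂ e)))

      owner-colour : ∀ e → π (owner e) ≡ colour (inj₂ e)
      owner-colour e = proj₂ (injective⇒surjective π-injective (colour (inj₂ e)))

      owner-∈ₑ : ∀ e → owner e ∈ₑ e
      owner-∈ₑ e with owner e ∈ₑ? e
      ... | yes owner∈e = owner∈e
      ... | no owner∉e =
        contradiction (sym (owner-colour e)) (proper (inj₂ e) (inj₁ (owner e)) ((λ ()) , owner∉e))

      owner-injective : Injective _≡_ _≡_ owner
      owner-injective {e} {e'} eq with e ≟ₑ e'
      ... | yes e≡e' = e≡e'
      ... | no e≢e' =
        contradiction (trans (sym (owner-colour e)) (trans (cong π eq) (owner-colour e')))
                      (proper (inj₂ e) (inj₂ e') (e≢e' ∘ Sum.inj₂-injective , λ ()))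

    choiceOf : EndpointChoice
    choiceOf = record
      { choose = owner
      ; choose-∈ₑ = owner-∈ₑ
      ; choose-injective = owner-injective
      }

    partitionOf-choiceOf : SamePart (partitionOf choiceOf) P
    partitionOf-choiceOf = SamePart-viaInjection (partitionOf choiceOf) P {π} π-injective λ where
      (inj₁ x) → refl
      (inj₂ e) → sym (owner-colour e)

module Rooted {n} (G : SimpleGraph n) (connected : Connected G) (root : Fin n) where
  open Subdivision G

  WithinDistance : ℕ → Fin n → Set
  WithinDistance zero x = x ≡ root
  WithinDistance (suc k) x = x ≡ root ⊎ ∃ λ y → Adj G x y × WithinDistance k y

  withinDistance? : ∀ k x → Dec (WithinDistance k x)
  withinDistance? zero x = x Fin.≟ root
  withinDistance? (suc k) x =
    (x Fin.≟ root) ⊎-dec Fin.any? (λ y → Adj? x y ×-dec withinDistance? k y)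

  walk⇒withinDistance : ∀ {x} → Walk G x root → ∃ λ k → WithinDistance k x
  walk⇒withinDistance [] = zero , refl
  walk⇒withinDistance (x~y ∷ w) with walk⇒withinDistance w
  ... | k , y-near = suc k , inj₂ (_ , x~y , y-near)

  Distance : Fin n → Set
  Distance x = ∃ λ k → WithinDistance k x × (∀ j → WithinDistance j x → k ≤ j)

  distance : ∀ x → Distance x
  distance x with walk⇒withinDistance (connected x root)
  ... | k , x-near = least (λ j → withinDistance? j x) k x-near

  depth : Fin n → ℕ
  depth x = proj₁ (distance x)

  depth-minimal : ∀ {j x} → WithinDistance j x → depth x ≤ j
  depth-minimal {j} {x} = proj₂ (proj₂ (distance x)) j

  depth-root : depth root ≡ 0
  depth-root = ℕ.n≤0⇒n≡0 (depth-minimal {0} refl)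

  towardsRoot : ∀ x → x ≡ root ⊎ ∃ λ y → Adj G x y × depth y ℕ.< depth x
  towardsRoot x = step (distance x)
    where
    step : (d : Distance x) → x ≡ root ⊎ ∃ λ y → Adj G x y × depth y ℕ.< proj₁ d
    step (zero , x≡root , _) = inj₁ x≡root
    step (suc k , inj₁ x≡root , _) = inj₁ x≡root
    step (suc k , inj₂ (y , x~y , y-near) , _) = inj₂ (y , x~y , s≤s (depth-minimal y-near))

  parent : Fin n → Fin n
  parent x with towardsRoot x
  ... | inj₁ _ = root
  ... | inj₂ (y , _) = y

  parent-spec : ∀ {x} → x ≢ root → Adj G x (parent x) × depth (parent x) ℕ.< depth x
  parent-spec {x} x≢root with towardsRoot x
  ... | inj₁ x≡root = contradiction x≡root x≢root
  ... | inj₂ (_ , x~y , closer) = x~y , closer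

  parent-adjacent : ∀ {x} → x ≢ root → Adj G x (parent x)
  parent-adjacent = proj₁ ∘ parent-spec

  parent-closer : ∀ {x} → x ≢ root → depth (parent x) ℕ.< depth x
  parent-closer = proj₂ ∘ parent-spec

  depth-≤-root : ∀ {x} → depth x ≤ depth root → x ≡ root
  depth-≤-root {x} x≤root with x Fin.≟ root
  ... | yes x≡root = x≡root
  ... | no x≢root = contradiction (subst (depth x ≤_) depth-root x≤root)
                                  (ℕ.<⇒≱ (ℕ.≤-<-trans z≤n (parent-closer x≢root)))

  parent-≢ : ∀ {x} → x ≢ root → parent x ≢ x
  parent-≢ x≢root px≡x = ℕ.<-irrefl (cong depth px≡x) (parent-closer x≢root)

  grandparent-≢ : ∀ {x} → x ≢ root → parent x ≢ root → parent (parent x) ≢ x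
  grandparent-≢ {x} x≢root px≢root ppx≡x =
    ℕ.<-asym (parent-closer x≢root)
             (subst (λ z → depth z ℕ.< depth (parent x)) ppx≡x (parent-closer px≢root))

  headOr : List (Fin n) → Fin n → Fin n
  headOr [] y = y
  headOr (z ∷ _) _ = z

  headOr-∷ʳ : ∀ xs x y → headOr (xs ∷ʳ x) y ≡ headOr xs x
  headOr-∷ʳ [] _ _ = refl
  headOr-∷ʳ (_ ∷ _) _ _ = refl

  -- A path whose inner vertices are at least as deep as both ends, and which leaves neither end
  -- through that end's parent edge (headOr picks the neighbour of an end on the path).
  record HangingPath : Set where
    field
      left right : Fin n
      inner : List (Fin n)
      distinct : AllPairs _≢_ (left ∷ inner ∷ʳ right)
      linked : Linked (Adj G) (left ∷ inner ∷ʳ right)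
      hangs : All (λ z → depth left ≤ depth z × depth right ≤ depth z) inner
      left-turn : left ≢ root → headOr inner right ≢ parent left
      right-turn : right ≢ root → headOr (reverse inner) left ≢ parent right

    height : ℕ
    height = depth left + depth right

    ends-distinct : left ≢ right
    ends-distinct = All.head (Allₚ.++⁻ʳ inner (AllPairs.head distinct))
  open HangingPath

  reversed : HangingPath → HangingPath
  reversed h = record
    { left = right h
    ; right = left h
    ; inner = reverse (inner h)
    ; distinct = subst (AllPairs _≢_) reverse-path (AllPairs-reverse⁺ ≢-sym (distinct h))
    ; linked = subst (Linked (Adj G)) reverse-path (Linked-reverse⁺ Adj-sym (linked h))
    ; hangs = All-reverse⁺ (All.map swap (hangs h))
    ; left-turn = right-turn h
    ; right-turn = subst (λ zs → headOr zs (right h) ≢ parent (left h))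
                         (sym (reverse-involutive (inner h)))
                   ∘ left-turn h
    }
    where
    reverse-path = reverse-∷-∷ʳ (left h) (inner h) (right h)

  closeLeft : (h : HangingPath) → left h ≢ root → parent (left h) ≡ right h → HasCycle G
  closeLeft h l≢root pl≡r =
    left h , inner h ∷ʳ right h , longEnough (inner h) (left-turn h) , distinct h ,
    Linked-∷ʳ⁺ {xs = left h ∷ inner h} (linked h) r~l
    where
    r~l : Adj G (right h) (left h)
    r~l = subst (λ z → Adj G z (left h)) pl≡r (Adj-sym (parent-adjacent l≢root))

    longEnough : ∀ zs → (left h ≢ root → headOr zs (right h) ≢ parent (left h)) →
                 2 ≤ length (zs ∷ʳ right h)
    longEnough [] turn = contradiction (sym pl≡r) (turn l≢root)
    longEnough (_ ∷ []) _ = s≤s (s≤s z≤n)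
    longEnough (_ ∷ _ ∷ _) _ = s≤s (s≤s z≤n)

  climbLeft : (h : HangingPath) → depth (right h) ≤ depth (left h) →
              left h ≢ root → parent (left h) ≢ right h → HangingPath
  climbLeft h r≤l l≢root pl≢r = record
    { left = parent (left h)
    ; right = right h
    ; inner = left h ∷ inner h
    ; distinct = (parent-≢ l≢root ∷ Allₚ.∷ʳ⁺ (All.map parent-∉inner (hangs h)) pl≢r) ∷ distinct h
    ; linked = Adj-sym (parent-adjacent l≢root) ∷ linked h
    ; hangs = (pl≤l , r≤l) ∷ All.map (λ (l≤z , r≤z) → ℕ.≤-trans pl≤l l≤z , r≤z) (hangs h)
    ; left-turn = ≢-sym ∘ grandparent-≢ l≢root
    ; right-turn = subst (_≢ parent (right h)) (sym next-to-right) ∘ right-turn h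
    }
    where
    pl≤l = ℕ.<⇒≤ (parent-closer l≢root)

    parent-∉inner : ∀ {z} → depth (left h) ≤ depth z × depth (right h) ≤ depth z →
                    parent (left h) ≢ z
    parent-∉inner (l≤z , _) pl≡z =
      ℕ.<-irrefl (cong depth pl≡z) (ℕ.<-≤-trans (parent-closer l≢root) l≤z)

    next-to-right : headOr (reverse (left h ∷ inner h)) (parent (left h)) ≡
                    headOr (reverse (inner h)) (left h)
    next-to-right =
      trans (cong (λ zs → headOr zs (parent (left h))) (unfold-reverse (left h) (inner h)))
            (headOr-∷ʳ (reverse (inner h)) (left h) (parent (left h)))

  Lowerable : HangingPath → Set
  Lowerable h = HasCycle G ⊎ Σ HangingPath λ h' → height h' ℕ.< height h

  lowerLeft : (h : HangingPath) → depth (right h) ≤ depth (left h) → Lowerable h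
  lowerLeft h r≤l with left h Fin.≟ root | parent (left h) Fin.≟ right h
  ... | yes l≡root | _ = contradiction (trans l≡root (sym r≡root)) (ends-distinct h)
    where
    r≡root = depth-≤-root (subst (λ z → depth (right h) ≤ depth z) l≡root r≤l)
  ... | no l≢root | yes pl≡r = inj₁ (closeLeft h l≢root pl≡r)
  ... | no l≢root | no pl≢r =
    inj₂ (climbLeft h r≤l l≢root pl≢r , ℕ.+-monoˡ-< (depth (right h)) (parent-closer l≢root))

  lower : (h : HangingPath) → Lowerable h
  lower h with ℕ.≤-total (depth (right h)) (depth (left h))
  ... | inj₁ r≤l = lowerLeft h r≤l
  ... | inj₂ l≤r = Sum.map₂ (λ (h' , lower') → h' , subst (height h' ℕ.<_) height-reversed lower')
                            (lowerLeft (reversed h) l≤r)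
    where
    height-reversed = ℕ.+-comm (depth (right h)) (depth (left h))

  hangingPath⇒cycle : HangingPath → HasCycle G
  hangingPath⇒cycle h = go h (<-wellFounded (height h))
    where
    go : (h : HangingPath) → Acc ℕ._<_ (height h) → HasCycle G
    go h (acc rec) = [ id , (λ (h' , lower') → go h' (rec lower')) ]′ (lower h)

module RootedTree {n} (T : SimpleGraph n) (connected : Connected T) (acyclic : ¬ HasCycle T)
                  (root : Fin n) where
  open Subdivision T
  open Rooted T connected root public

  -- Otherwise the edge alone is a hanging path, and lowering it ends in a cycle.
  parent-edge : ∀ {u v} → Adj T u v → (u ≢ root × parent u ≡ v) ⊎ (v ≢ root × parent v ≡ u)
  parent-edge {u} {v} u~v
    with ¬? (u Fin.≟ root) ×-dec parent u Fin.≟ v | ¬? (v Fin.≟ root) ×-dec parent v Fin.≟ u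
  ... | yes u↑v | _ = inj₁ u↑v
  ... | no _ | yes v↑u = inj₂ v↑u
  ... | no ¬u↑v | no ¬v↑u = contradiction (hangingPath⇒cycle edgePath) acyclic
    where
    edgePath : HangingPath
    edgePath = record
      { left = u
      ; right = v
      ; inner = []
      ; distinct = (Adj-irrefl u~v ∷ []) ∷ [] ∷ []
      ; linked = u~v ∷ [-]
      ; hangs = []
      ; left-turn = λ u≢root v≡pu → ¬u↑v (u≢root , sym v≡pu)
      ; right-turn = λ v≢root u≡pv → ¬v↑u (v≢root , sym u≡pv)
      }

  child : Edge → Fin n
  child ((u , v) , _ , u~v) with parent-edge u~v
  ... | inj₁ _ = u
  ... | inj₂ _ = v

  child-spec : ∀ e → child e ≢ root × Joins e (child e) (parent (child e))
  child-spec ((u , v) , _ , u~v) with parent-edge u~v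
  ... | inj₁ (u≢root , pu≡v) = u≢root , inj₁ (refl , sym pu≡v)
  ... | inj₂ (v≢root , pv≡u) = v≢root , inj₂ (sym pv≡u , refl)

  child-≢-root : ∀ e → child e ≢ root
  child-≢-root = proj₁ ∘ child-spec

  child-joins : ∀ e → Joins e (child e) (parent (child e))
  child-joins = proj₂ ∘ child-spec

  child-injective : Injective _≡_ _≡_ child
  child-injective {e} {e'} eq =
    Joins-injective e e' (child-joins e) (subst (λ z → Joins e' z (parent z)) (sym eq) (child-joins e'))

  childChoice : EndpointChoice
  childChoice = record
    { choose = child
    ; choose-∈ₑ = λ e → Joins⇒∈ₑ e (child-joins e)
    ; choose-injective = child-injective
    }

  child-rootEdge : ∀ {s} (r~s : Adj T root s) → child (edge r~s) ≡ s
  child-rootEdge r~s with ∈ₑ-Joins (edge r~s) (edge-joins r~s) (choose-∈ₑ childChoice (edge r~s))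
  ... | inj₁ c≡root = contradiction c≡root (child-≢-root (edge r~s))
  ... | inj₂ c≡s = c≡s

  parentEdge : ∀ {x} → x ≢ root → Edge
  parentEdge = edge ∘ parent-adjacent

  parentEdge-joins : ∀ {x} (x≢root : x ≢ root) → Joins (parentEdge x≢root) x (parent x)
  parentEdge-joins = edge-joins ∘ parent-adjacent

  parentEdge-cong : ∀ {x x'} (x≢root : x ≢ root) (x'≢root : x' ≢ root) → x ≡ x' →
                    parentEdge x≢root ≡ parentEdge x'≢root
  parentEdge-cong x≢root x'≢root refl =
    Joins-injective _ _ (parentEdge-joins x≢root) (parentEdge-joins x'≢root)

  parentEdge-child : ∀ e → parentEdge (child-≢-root e) ≡ e
  parentEdge-child e = Joins-injective _ e (parentEdge-joins (child-≢-root e)) (child-joins e)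

  child-parentEdge : ∀ {x} (x≢root : x ≢ root) → child (parentEdge x≢root) ≡ x
  child-parentEdge x≢root
    with Joins-endpoints (parentEdge x≢root) (child-joins (parentEdge x≢root)) (parentEdge-joins x≢root)
  ... | inj₁ (c≡x , _) = c≡x
  ... | inj₂ (c≡px , pc≡x) =
    contradiction (trans (cong parent (sym c≡px)) pc≡x)
                  (grandparent-≢ x≢root (subst (_≢ root) c≡px (child-≢-root (parentEdge x≢root))))

  parentEdge-≢-parentEdge-parent : ∀ {x} (x≢root : x ≢ root) (px≢root : parent x ≢ root) →
                                   parentEdge x≢root ≢ parentEdge px≢root
  parentEdge-≢-parentEdge-parent x≢root px≢root same =
    parent-≢ x≢root (trans (sym (child-parentEdge px≢root))
                           (trans (cong child (sym same)) (child-parentEdge x≢root)))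

  -- By induction on depth: the parent end of a parent edge is already chosen for the parent's own
  -- parent edge (or is the root, which is avoided).
  choice-unique : (A : EndpointChoice) → (∀ e → choose A e ≢ root) → ∀ e → choose A e ≡ child e
  choice-unique A avoids e = begin
    choose A e                             ≡⟨ cong (choose A) (sym (parentEdge-child e)) ⟩
    choose A (parentEdge (child-≢-root e)) ≡⟨ choosesChild (child-≢-root e) (<-wellFounded _) ⟩
    child e                                ∎
    where
    open ≡-Reasoning

    choosesChild : ∀ {x} (x≢root : x ≢ root) → Acc ℕ._<_ (depth x) → choose A (parentEdge x≢root) ≡ x
    choosesChild x≢root (acc rec)
      with ∈ₑ-Joins (parentEdge x≢root) (parentEdge-joins x≢root) (choose-∈ₑ A (parentEdge x≢root))
    ... | inj₁ chose-x = chose-x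
    ... | inj₂ chose-px = contradiction sameEdge (parentEdge-≢-parentEdge-parent x≢root px≢root)
      where
      px≢root = λ px≡root → avoids _ (trans chose-px px≡root)

      sameEdge : parentEdge x≢root ≡ parentEdge px≢root
      sameEdge = choose-injective A
        (trans chose-px (sym (choosesChild px≢root (rec (parent-closer x≢root)))))

  module _ (A : EndpointChoice) where
    private
      HitFrom : Fin n → Fin n → Set
      HitFrom y x = Σ (x ≢ root) λ x≢root → choose A (parentEdge x≢root) ≡ y

      hitFrom? : ∀ y x → Dec (HitFrom y x)
      hitFrom? y x with x Fin.≟ root
      ... | yes x≡root = no λ (x≢root , _) → x≢root x≡root
      ... | no x≢root =
        map′ (x≢root ,_)
             (λ (x≢root' , eq) → trans (cong (choose A) (parentEdge-cong x≢root x≢root' refl)) eq)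
             (choose A (parentEdge x≢root) Fin.≟ y)

    -- Every edge is the parent edge of a non-root vertex, so if every vertex y were hit, choosing
    -- such a vertex for each y would inject all n vertices into the n − 1 non-root ones.
    choice-avoids-vertex : ∃ λ y → ∀ e → choose A e ≢ y
    choice-avoids-vertex with Fin.any? (λ y → ¬? (Fin.any? (hitFrom? y)))
    ... | yes (y , ¬hit) = y , λ e chose-y →
      ¬hit (child e , child-≢-root e , trans (cong (choose A) (parentEdge-child e)) chose-y)
    ... | no ¬unhit = contradiction (injective⇒surjective source-injective root)
                                    λ (y , source≡root) → proj₁ (proj₂ (hitBy y)) source≡root
      where
      hitBy : ∀ y → ∃ (HitFrom y)
      hitBy y = decidable-stable (Fin.any? (hitFrom? y)) (λ ¬hit → ¬unhit (y , ¬hit))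

      source : Fin n → Fin n
      source y = proj₁ (hitBy y)

      source-injective : Injective _≡_ _≡_ source
      source-injective {y} {y'} eq with hitBy y | hitBy y'
      ... | x , x≢root , chose-y | x' , x'≢root , chose-y' =
        trans (sym chose-y) (trans (cong (choose A) (parentEdge-cong x≢root x'≢root eq)) chose-y')

module SubdividedTree {m} (T : SimpleGraph (suc m)) (connected : Connected T)
                      (acyclic : ¬ HasCycle T) where
  open Subdivision T
  private
    n = suc m
  open module At (r : Fin n) = RootedTree T connected acyclic r
    using (child; child-≢-root; child-injective; childChoice; child-rootEdge; parentEdge;
           parentEdge-joins; child-parentEdge; parent; parent-adjacent; choice-unique;
           choice-avoids-vertex)

  _≟ᵥ_ : DecidableEquality (SubdivV T)
  _≟ᵥ_ = Sum.≡-dec Fin._≟_ _≟ₑ_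

  rootedPartition : Fin n → Partition
  rootedPartition r = partitionOf (childChoice r)

  -- Choosing r on the edge rs and the child towards r elsewhere avoids s, so it is the choice of
  -- children towards s.
  child-adjacentRoots : ∀ {r s} (r~s : Adj T r s) → ∀ e → e ≢ edge r~s → child r e ≡ child s e
  child-adjacentRoots {r} {s} r~s e e≢rs = begin
    child r e          ≡⟨ pick-other (e ≟ₑ rs) ⟩
    choose rerooted e  ≡⟨ choice-unique s rerooted (λ e → avoids-s (e ≟ₑ rs)) e ⟩
    child s e          ∎
    where
    open ≡-Reasoning
    rs = edge r~s

    pick : ∀ {e} → Dec (e ≡ rs) → Fin n
    pick (yes _) = r
    pick {e} (no _) = child r e

    pick-∈ₑ : ∀ {e} (e≟rs : Dec (e ≡ rs)) → pick e≟rs ∈ₑ e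
    pick-∈ₑ (yes refl) = Joins⇒∈ₑ rs (edge-joins r~s)
    pick-∈ₑ {e} (no _) = choose-∈ₑ (childChoice r) e

    pick-injective : ∀ {e e'} (e≟rs : Dec (e ≡ rs)) (e'≟rs : Dec (e' ≡ rs)) →
                     pick e≟rs ≡ pick e'≟rs → e ≡ e'
    pick-injective (yes e≡rs) (yes e'≡rs) _ = trans e≡rs (sym e'≡rs)
    pick-injective {e' = e'} (yes _) (no _) r≡c = contradiction (sym r≡c) (child-≢-root r e')
    pick-injective {e} (no _) (yes _) c≡r = contradiction c≡r (child-≢-root r e)
    pick-injective (no _) (no _) eq = child-injective r eq

    rerooted : EndpointChoice
    rerooted = record
      { choose = λ e → pick (e ≟ₑ rs)
      ; choose-∈ₑ = λ e → pick-∈ₑ (e ≟ₑ rs)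
      ; choose-injective = λ {e} {e'} → pick-injective (e ≟ₑ rs) (e' ≟ₑ rs)
      }

    avoids-s : ∀ {e} (e≟rs : Dec (e ≡ rs)) → pick e≟rs ≢ s
    avoids-s (yes _) = Adj-irrefl r~s
    avoids-s (no e≢rs) c≡s = e≢rs (child-injective r (trans c≡s (sym (child-rootEdge r r~s))))

    pick-other : (e≟rs : Dec (e ≡ rs)) → child r e ≡ pick e≟rs
    pick-other (yes e≡rs) = contradiction e≡rs e≢rs
    pick-other (no _) = refl

  rootedPartition-injective : ∀ r s → SamePart (rootedPartition r) (rootedPartition s) → r ≡ s
  rootedPartition-injective r s same with r Fin.≟ s
  ... | yes r≡s = r≡s
  ... | no r≢s =
    contradiction (proj₁ (same (inj₂ e) (inj₁ s)) (child-parentEdge r s≢r)) (child-≢-root s e)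
    where
    s≢r = r≢s ∘ sym
    e = parentEdge r s≢r

  rootedPartition-surjective : ∀ P → ∃ λ r → SamePart (rootedPartition r) P
  rootedPartition-surjective P with choice-avoids-vertex Fin.zero (choiceOf P)
  ... | r , avoids =
    r , SamePart-trans (rootedPartition r) (partitionOf (choiceOf P)) P
          (partitionOf-cong (sym ∘ choice-unique r (choiceOf P) avoids))
          (partitionOf-choiceOf P)

  adjacent⇒bellAdjacent : ∀ {r s} → Adj T r s → BellAdj (rootedPartition r) (rootedPartition s)
  adjacent⇒bellAdjacent {r} {s} r~s =
    Adj-irrefl r~s ∘ rootedPartition-injective r s ,
    inj₂ (edge r~s) ,
    SamePartMinus-pointwise (rootedPartition r) (rootedPartition s) λ where
      (inj₁ x) _ → refl
      (inj₂ e) e≢rs → child-adjacentRoots r~s e (e≢rs ∘ cong inj₂)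

  -- The deleted vertex v must separate s from the edge to its parent towards r, and r from the
  -- edge to its parent towards s; so these are one edge, which then joins r and s.
  bellAdjacent⇒adjacent : ∀ {r s} → BellAdj (rootedPartition r) (rootedPartition s) → Adj T r s
  bellAdjacent⇒adjacent {r} {s} (¬same , v , same-v) with r Fin.≟ s
  ... | yes refl = contradiction (SamePart-refl (rootedPartition r)) ¬same
  ... | no r≢s = meet
    (SamePartMinus-separated _≟ᵥ_ (rootedPartition r) (rootedPartition s) same-v
       (child-parentEdge r s≢r) (child-≢-root s e₁))
    (SamePartMinus-separated _≟ᵥ_ (rootedPartition s) (rootedPartition r)
       (SamePartMinus-sym (rootedPartition r) (rootedPartition s) same-v)
       (child-parentEdge s r≢s) (child-≢-root r e₂))
    where
    s≢r = r≢s ∘ sym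
    e₁ = parentEdge r s≢r
    e₂ = parentEdge s r≢s

    sameEdge : e₂ ≡ e₁ → Adj T r s
    sameEdge e₂≡e₁ with Joins-endpoints e₁ (parentEdge-joins r s≢r)
                          (subst (λ e → Joins e r (parent s r)) e₂≡e₁ (parentEdge-joins s r≢s))
    ... | inj₁ (s≡r , _) = contradiction s≡r s≢r
    ... | inj₂ (_ , pr≡r) = Adj-sym (subst (Adj T s) pr≡r (parent-adjacent r s≢r))

    meet : inj₂ e₁ ≡ v ⊎ inj₁ s ≡ v → inj₂ e₂ ≡ v ⊎ inj₁ r ≡ v → Adj T r s
    meet (inj₁ e₁≡v) (inj₁ e₂≡v) = sameEdge (Sum.inj₂-injective (trans e₂≡v (sym e₁≡v)))
    meet (inj₁ e₁≡v) (inj₂ r≡v) = contradiction (trans e₁≡v (sym r≡v)) λ ()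
    meet (inj₂ s≡v) (inj₁ e₂≡v) = contradiction (trans e₂≡v (sym s≡v)) λ ()
    meet (inj₂ s≡v) (inj₂ r≡v) = contradiction (Sum.inj₁-injective (trans r≡v (sym s≡v))) r≢s

  bellIso : BellIso (SubdivV T) (ComplAdj (SubdivAdj T)) n T
  bellIso = rootedPartition , rootedPartition-injective , rootedPartition-surjective ,
            λ r s → adjacent⇒bellAdjacent , bellAdjacent⇒adjacent

corollary4p8 : (n : ℕ) → 2 ≤ n → (T : SimpleGraph n) → IsTree T →
    BellIso (SubdivV T) (ComplAdj (SubdivAdj T)) n T
corollary4p8 (suc m) _ T (connected , acyclic) = SubdividedTree.bellIso T connected acyclic
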